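{- Let $G$ be a BK-free graph with $\Delta(G)\ge 9$ and $\omega(G)<\Delta(G)$. Then every interval $2$-join $(H,A_1,A_2,B_1,B_2)$ in $G$ is either trivial ($A_1=A_2$) or canonical ($A_1\cap A_2=\emptyset$).
   Context: A linear interval graph is a graph whose vertices can be ordered $v_1,\dots,v_t$ on a line so that the closed neighborhood of each vertex is a set of consecutive vertices containing it. An interval $2$-join in $G$ is an induced subgraph $H$ with cliques $A_1,A_2\subseteq V(H)$ and $B_1,B_2\subseteq V(G)\setminus V(H)$ such that: $H$ is a nonempty linear interval graph with ordering $v_1,\dots,v_t$, $A_1=\{v_1,\dots,v_L\}$ and $A_2=\{v_R,\dots,v_t\}$ are cliques (the ends of $H$, not necessarily disjoint); $B_1,B_2$ are cliques of $G\setminus H$ (not necessarily disjoint); $A_1$ is complete to $B_1$, $A_2$ is complete to $B_2$; and there are no other edges between $H$ and $G-H$. It is trivial if $V(H)=A_1=A_2$ and canonical if $A_1\cap A_2=\emptyset$. For an orientation $D$ of a graph, a spanning Eulerian subgraph is a spanning subdigraph in which every vertex has equal in- and outdegree; $EE(D)$, $EO(D)$ are the sets of those with an even, resp. odd, number of edges. A graph $H$ is $f$-AT if it has an orientation $D$ with $f(v)>d^+_D(v)$ for all $v$ and $|EE(D)|\ne|EO(D)|$. A kernel of a digraph is an independent set $I$ such that every vertex not in $I$ has an out-neighbor in $I$; a digraph is kernel-perfect if every induced subdigraph has a kernel. $H$ is $f$-KP if some multigraph $H'$ on vertex set $V(H)$ containing $H$ has a kernel-perfect orientation with $f(v)>d^+(v)$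 for all $v$. A connected graph $G$ is BK-free if it has no induced subgraph $H$ that is $f_H$-AT or $f_H$-KP, where $f_H(v)=d_H(v)-1+\Delta(G)-d_G(v)$. -}

module Defs where

open import Data.Bool using (Bool; true; false; if_then_else_; _∧_; not)
open import Data.Nat as ℕ using (ℕ; zero; suc; _+_; _≤_; _<_; _⊔_; _≡ᵇ_)
open import Data.Integer as ℤ using (ℤ; +_)
open import Data.Fin using (Fin; zero; suc; toℕ)
open import Data.List using (List; []; _∷_; _++_; map; length; concatMap; allFin; filterᵇ)
open import Data.Product using (Σ; _×_; _,_; ∃; ∃-syntax)
open import Data.Sum using (_⊎_)
open import Data.Empty using (⊥)
open import Relation.Nullary using (¬_)
open import Relation.Binary.PropositionalEquality using (_≡_; _≢_)
open import Function using (_∘_)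
open import Function.Definitions using (Injective)

count : ∀ {k} → (Fin k → Bool) → ℕ
count {zero}  f = 0
count {suc k} f = (if f zero then 1 else 0) + count (f ∘ suc)

sumF : ∀ {k} → (Fin k → ℕ) → ℕ
sumF {zero}  f = 0
sumF {suc k} f = f zero + sumF (f ∘ suc)

maxF : ∀ {k} → (Fin k → ℕ) → ℕ
maxF {zero}  f = 0
maxF {suc k} f = f zero ⊔ maxF (f ∘ suc)

allB : ∀ {a} {A : Set a} → (A → Bool) → List A → Bool
allB p []       = true
allB p (x ∷ xs) = p x ∧ allB p xs

isEven : ℕ → Bool
isEven zero          = true
isEven (suc zero)    = false
isEven (suc (suc n)) = isEven n

sublists : ∀ {a} {A : Set a} → List A → List (List A)
sublists []       = [] ∷ []
sublists (x ∷ xs) = sublists xs ++ map (x ∷_) (sublists xs)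

record Graph (n : ℕ) : Set where
  field
    adj     : Fin n → Fin n → Bool
    sym     : ∀ u v → adj u v ≡ adj v u
    irrefl  : ∀ v → adj v v ≡ false
open Graph public

deg : ∀ {n} → Graph n → Fin n → ℕ
deg G v = count (adj G v)

Δ : ∀ {n} → Graph n → ℕ
Δ G = maxF (deg G)

IsClique : ∀ {n} → Graph n → (Fin n → Bool) → Set
IsClique G C = ∀ u v → C u ≡ true → C v ≡ true → u ≢ v → adj G u v ≡ true

-- ω(G) < Δ(G): every clique has fewer than Δ(G) vertices
CliqueNumberBelow : ∀ {n} → Graph n → ℕ → Set
CliqueNumberBelow G d = ∀ C → IsClique G C → count C < d

data Reach {n} (G : Graph n) (u : Fin n) : Fin n → Set where
  here : Reach G u u
  step : ∀ {v w} → Reach G u v → adj G v w ≡ true → Reach G u w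

Connected : ∀ {n} → Graph n → Set
Connected {n} G = (1 ≤ n) × (∀ u v → Reach G u v)

-- induced subgraph on the image of an (injective) map ι : Fin k → Fin n
induced : ∀ {n k} → Graph n → (Fin k → Fin n) → Graph k
induced G ι = record
  { adj    = λ u v → adj G (ι u) (ι v)
  ; sym    = λ u v → sym G (ι u) (ι v)
  ; irrefl = λ v → irrefl G (ι v) }

record Orientation {k} (H : Graph k) : Set where
  field
    arc      : Fin k → Fin k → Bool
    arc⇒adj  : ∀ u v → arc u v ≡ true → adj H u v ≡ true
    adj⇒arc  : ∀ u v → adj H u v ≡ true → (arc u v ≡ true) ⊎ (arc v u ≡ true)
    antisym  : ∀ u v → arc u v ≡ true → arc v u ≡ false
open Orientation public

outdeg : ∀ {k} {H : Graph k} → Orientation H → Fin k → ℕ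
outdeg D v = count (arc D v)

arcList : ∀ {k} {H : Graph k} → Orientation H → List (Fin k × Fin k)
arcList {k} D = concatMap (λ u → map (u ,_) (filterᵇ (arc D u) (allFin k))) (allFin k)

outIn : ∀ {k} → Fin k → List (Fin k × Fin k) → ℕ
outIn v []             = 0
outIn v ((a , b) ∷ xs) = (if toℕ a ≡ᵇ toℕ v then 1 else 0) + outIn v xs

inIn : ∀ {k} → Fin k → List (Fin k × Fin k) → ℕ
inIn v []             = 0
inIn v ((a , b) ∷ xs) = (if toℕ b ≡ᵇ toℕ v then 1 else 0) + inIn v xs

-- a set of arcs is a spanning Eulerian subgraph iff indeg = outdeg everywhere
isEulerian : ∀ {k} → List (Fin k × Fin k) → Bool
isEulerian {k} S = allB (λ v → outIn v S ≡ᵇ inIn v S) (allFin k)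

EE : ∀ {k} {H : Graph k} → Orientation H → ℕ
EE D = length (filterᵇ (λ S → isEulerian S ∧ isEven (length S)) (sublists (arcList D)))

EO : ∀ {k} {H : Graph k} → Orientation H → ℕ
EO D = length (filterᵇ (λ S → isEulerian S ∧ not (isEven (length S))) (sublists (arcList D)))

is-f-AT : ∀ {k} → (H : Graph k) → (Fin k → ℤ) → Set
is-f-AT H f = Σ (Orientation H) λ D → (∀ v → + outdeg D v ℤ.< f v) × (EE D ≢ EO D)

IsKernel : ∀ {k} → (Fin k → Fin k → Set) → (S I : Fin k → Bool) → Set
IsKernel R S I =
  (∀ v → I v ≡ true → S v ≡ true) ×
  (∀ u v → I u ≡ true → I v ≡ true → ¬ R u v) ×
  (∀ u → S u ≡ true → I u ≡ false → ∃[ v ] (I v ≡ true × R u v))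

-- every induced subdigraph (on vertex set S) has a kernel
KernelPerfect : ∀ {k} → (Fin k → Fin k → Set) → Set
KernelPerfect R = ∀ S → ∃[ I ] IsKernel R S I

-- a loopless multigraph H' on V(H) containing H, together with an orientation:
-- mult u v = number of parallel edges uv, arcs u v = number oriented u → v
record MultiOrientation {k} (H : Graph k) : Set where
  field
    mult      : Fin k → Fin k → ℕ
    mult-sym  : ∀ u v → mult u v ≡ mult v u
    loopless  : ∀ v → mult v v ≡ 0
    contains  : ∀ u v → adj H u v ≡ true → 1 ≤ mult u v
    arcs      : Fin k → Fin k → ℕ
    split     : ∀ u v → arcs u v + arcs v u ≡ mult u v
open MultiOrientation public

mOutdeg : ∀ {k} {H : Graph k} → MultiOrientation H → Fin k → ℕ
mOutdeg D v = sumF (arcs D v)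

mArc : ∀ {k} {H : Graph k} → MultiOrientation H → Fin k → Fin k → Set
mArc D u v = 1 ≤ arcs D u v

is-f-KP : ∀ {k} → (H : Graph k) → (Fin k → ℤ) → Set
is-f-KP H f = Σ (MultiOrientation H) λ D →
  KernelPerfect (mArc D) × (∀ v → + mOutdeg D v ℤ.< f v)

fH : ∀ {n k} → (G : Graph n) → (Fin k → Fin n) → Fin k → ℤ
fH G ι v = + deg (induced G ι) v ℤ.- + 1 ℤ.+ + Δ G ℤ.- + deg G (ι v)

BKFree : ∀ {n} → Graph n → Set
BKFree {n} G = Connected G ×
  (∀ k (ι : Fin k → Fin n) → Injective _≡_ _≡_ ι → 1 ≤ k →
     ¬ is-f-AT (induced G ι) (fH G ι) × ¬ is-f-KP (induced G ι) (fH G ι))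

-- the ordering v_0,...,v_{t-1} (0-indexed) makes H a linear interval graph:
-- each closed neighbourhood is a set of consecutive vertices
ClosedNbhd : ∀ {t} → Graph t → Fin t → Fin t → Set
ClosedNbhd H i j = (i ≡ j) ⊎ (adj H i j ≡ true)

LinearInterval : ∀ {t} → Graph t → Set
LinearInterval H = ∀ i j l m → toℕ j ≤ toℕ m → toℕ m ≤ toℕ l →
  ClosedNbhd H i j → ClosedNbhd H i l → ClosedNbhd H i m

-- A₁ = {v_0,...,v_{L-1}},  A₂ = {v_R,...,v_{t-1}}
EndA₁ : ∀ {t} → ℕ → Fin t → Set
EndA₁ L i = toℕ i < L

EndA₂ : ∀ {t} → ℕ → Fin t → Set
EndA₂ R i = R ≤ toℕ i

IsCliqueP : ∀ {n} → Graph n → (Fin n → Set) → Set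
IsCliqueP G C = ∀ u v → C u → C v → u ≢ v → adj G u v ≡ true

-- (H, A₁, A₂, B₁, B₂) is an interval 2-join of G, where H is the subgraph
-- induced on ι(0),...,ι(t-1), listed in the linear-interval order.
record Interval2Join {n} (G : Graph n) : Set₁ where
  field
    t        : ℕ
    ι        : Fin t → Fin n
    ι-inj    : Injective _≡_ _≡_ ι
    nonempty : 1 ≤ t
    linear   : LinearInterval (induced G ι)
    L R      : ℕ
    A₁clique : ∀ i j → EndA₁ {t} L i → EndA₁ {t} L j → i ≢ j → adj G (ι i) (ι j) ≡ true
    A₂clique : ∀ i j → EndA₂ {t} R i → EndA₂ {t} R j → i ≢ j → adj G (ι i) (ι j) ≡ true
    B₁ B₂    : Fin n → Set
    B₁-out   : ∀ x i → B₁ x → ι i ≢ x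
    B₂-out   : ∀ x i → B₂ x → ι i ≢ x
    B₁clique : IsCliqueP G B₁
    B₂clique : IsCliqueP G B₂
    A₁B₁     : ∀ i x → EndA₁ {t} L i → B₁ x → adj G (ι i) x ≡ true
    A₂B₂     : ∀ i x → EndA₂ {t} R i → B₂ x → adj G (ι i) x ≡ true
    no-other : ∀ i x → (∀ j → ι j ≢ x) → adj G (ι i) x ≡ true →
                 (EndA₁ {t} L i × B₁ x) ⊎ (EndA₂ {t} R i × B₂ x)

-- trivial: V(H) = A₁ = A₂
Trivial : ∀ {n} {G : Graph n} → Interval2Join G → Set
Trivial J = ∀ i → EndA₁ {t} L i × EndA₂ {t} R i
  where open Interval2Join J

Canonical : ∀ {n} {G : Graph n} → Interval2Join G → Set
Canonical J = ∀ i → ¬ (EndA₁ {t} L i × EndA₂ {t} R i)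
  where open Interval2Join J

module Submission where

-- BK-freeness is used only through small AT-certificates: a valid orientation of a
-- concrete pattern, checked by evaluation, cannot be induced with the prescribed
-- degree slack (certificate-excluded).  A single vertex gives |N[v]| ≥ Δ for every v
-- (closed-large); K₅ minus an edge gives almostK₅-excluded.
--
-- Counting then shows (module Dense): if N[p], N[q] ⊆ N[x] with p ≠ q and N[p] ∩ N[q]
-- a clique, then p, q have degree Δ − 1, are adjacent, have private neighbours z, z′
-- adjacent to x, and share with x a further neighbour w (Tight); and N[x] cannot
-- exceed some N[w] by two vertices.
--
-- For the join, let x ∈ A₁ ∩ A₂ and let p, q be the first and last vertex of H.  If p ∈ A₂
-- and q ∈ A₁ the join is trivial; if exactly one end misses its far side, its closed
-- neighbourhood is a clique of size ≥ Δ; otherwise x dominates H and N[p] ∩ N[q] is a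
-- clique, so p, q, x are Tight and w together with z or z′ induces an almost-K₅ (Hub).

open import Defs hiding (sym)
open import Defs using () renaming (sym to adj-sym)
open import Data.Bool using (Bool; true; false; not; _∧_; _∨_; if_then_else_)
open import Data.Bool.Properties using (∨-comm; ∨-conicalʳ; ∧-comm; ∧-zeroʳ; T-≡)
open import Data.Nat using (ℕ; zero; suc; pred; _+_; _∸_; _≤_; _<_; _≤ᵇ_; _≡ᵇ_; z≤n; s≤s)
import Data.Nat.Properties as ℕP
import Data.Integer as ℤ
import Data.Integer.Properties as ℤP
open import Data.Integer.Solver using (module +-*-Solver)
open import Data.Fin using (Fin; zero; suc; toℕ; fromℕ<; _≟_)
open import Data.Fin.Patterns using (0F; 1F; 2F; 3F; 4F)
import Data.Fin.Properties as FinP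
open import Data.Bool.ListAction using (any)
open import Data.List using (List; []; _∷_; length; map; concatMap; filterᵇ; allFin)
open import Data.List.Relation.Unary.All using (All; []; _∷_)
open import Data.Product using (_×_; _,_; proj₁; proj₂; ∃-syntax)
open import Data.Sum using (_⊎_; inj₁; inj₂)
open import Relation.Nullary using (¬_; yes; no; does)
open import Relation.Binary.Definitions using (tri<; tri≈; tri>)
open import Data.Empty using (⊥; ⊥-elim)
open import Function.Definitions using (Injective)
open import Relation.Nullary.Decidable using (dec-true; dec-false; _×-dec_)
open import Relation.Binary.PropositionalEquality
open import Function using (_∘_; Equivalence)

∧-true : ∀ {a b} → a ∧ b ≡ true → a ≡ true × b ≡ true
∧-true {true} b≡true = refl , b≡true

∨-true : ∀ {a b} → a ∨ b ≡ true → a ≡ true ⊎ b ≡ true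
∨-true {true}  _      = inj₁ refl
∨-true {false} b≡true = inj₂ b≡true

not-true : ∀ {a} → not a ≡ true → a ≡ false
not-true {false} _ = refl

true≢false : true ≢ false
true≢false ()

_==_ : ∀ {k} → Fin k → Fin k → Bool
u == v = does (u ≟ v)

==-refl : ∀ {k} (v : Fin k) → (v == v) ≡ true
==-refl v = dec-true (v ≟ v) refl

==-false : ∀ {k} {u v : Fin k} → u ≢ v → (u == v) ≡ false
==-false {u = u} {v} = dec-false (u ≟ v)

==-sound : ∀ {k} {u v : Fin k} → (u == v) ≡ true → u ≡ v
==-sound {u = u} {v} _ with u ≟ v
... | yes u≡v = u≡v

_⊆_ : ∀ {k} → (Fin k → Bool) → (Fin k → Bool) → Set
f ⊆ g = ∀ u → f u ≡ true → g u ≡ true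

count-cong : ∀ {k} {f g : Fin k → Bool} → (∀ u → f u ≡ g u) → count f ≡ count g
count-cong {zero}  _   = refl
count-cong {suc k} f≗g =
  cong₂ _+_ (cong (λ b → if b then 1 else 0) (f≗g zero)) (count-cong (f≗g ∘ suc))

count-mono : ∀ {k} {f g : Fin k → Bool} → f ⊆ g → count f ≤ count g
count-mono {zero} _ = z≤n
count-mono {suc k} {f} {g} f⊆g with f zero in fz | g zero in gz
... | true  | true  = s≤s (count-mono (f⊆g ∘ suc))
... | true  | false with () ← trans (sym (f⊆g zero fz)) gz
... | false | true  = ℕP.m≤n⇒m≤1+n (count-mono (f⊆g ∘ suc))
... | false | false = count-mono (f⊆g ∘ suc)

count-∪∩ : ∀ {k} (f g : Fin k → Bool) →
  count (λ u → f u ∨ g u) + count (λ u → f u ∧ g u) ≡ count f + count g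
count-∪∩ {zero}  f g = refl
count-∪∩ {suc k} f g with f zero | g zero | count-∪∩ (f ∘ suc) (g ∘ suc)
... | true  | true  | ih = cong suc (trans (ℕP.+-suc _ _) (trans (cong suc ih) (sym (ℕP.+-suc _ _))))
... | true  | false | ih = cong suc ih
... | false | true  | ih = trans (cong suc ih) (sym (ℕP.+-suc _ _))
... | false | false | ih = ih

count-split : ∀ {k} (f g : Fin k → Bool) →
  count f ≡ count (λ u → f u ∧ g u) + count (λ u → f u ∧ not (g u))
count-split {zero}  f g = refl
count-split {suc k} f g with f zero | g zero | count-split (f ∘ suc) (g ∘ suc)
... | true  | true  | ih = cong suc ih
... | true  | false | ih = trans (cong suc ih) (sym (ℕP.+-suc _ _))
... | false | _     | ih = ih

count-witness : ∀ {k} (f : Fin k → Bool) → 0 < count f → ∃[ u ] f u ≡ true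
count-witness {suc k} f pos with f zero in fz
... | true  = zero , fz
... | false with count-witness (f ∘ suc) pos
...   | u , fu = suc u , fu

count-difference : ∀ {k} (f g : Fin k → Bool) →
  count (λ u → f u ∧ g u) < count f → ∃[ u ] (f u ∧ not (g u) ≡ true)
count-difference f g f∩g<f = count-witness _ (ℕP.+-cancelˡ-≤ (count f∩g) 1 _ (begin
  count f∩g + 1                              ≡⟨ ℕP.+-comm (count f∩g) 1 ⟩
  suc (count f∩g)                            ≤⟨ f∩g<f ⟩
  count f                                    ≡⟨ count-split f g ⟩
  count f∩g + count (λ u → f u ∧ not (g u))  ∎))
  where
  open ℕP.≤-Reasoning
  f∩g : _ → Bool
  f∩g u = f u ∧ g u

count-insert : ∀ {k} {f : Fin k → Bool} (v : Fin k) → f v ≡ false →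
  count (λ u → (v == u) ∨ f u) ≡ suc (count f)
count-insert {suc k} zero    fv rewrite fv = refl
count-insert {suc k} {f} (suc v) fv =
  trans (cong ((if f zero then 1 else 0) +_) (count-insert {f = f ∘ suc} v fv)) (ℕP.+-suc _ _)

count-gap : ∀ {k} {f g : Fin k → Bool} (v : Fin k) →
  f ⊆ g → g v ≡ true → f v ≡ false → suc (count f) ≤ count g
count-gap {f = f} {g} v f⊆g gv fv =
  subst (_≤ count g) (count-insert v fv) (count-mono v∪f⊆g)
  where
  v∪f⊆g : (λ u → (v == u) ∨ f u) ⊆ g
  v∪f⊆g u h with ∨-true h
  ... | inj₁ v≡u = subst (λ w → g w ≡ true) (==-sound v≡u) gv
  ... | inj₂ fu  = f⊆g u fu

count-without : ∀ {k} {f : Fin k → Bool} (v : Fin k) →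
  count f ≤ suc (count (λ u → f u ∧ not (v == u)))
count-without {f = f} v =
  subst (count f ≤_) (count-insert v f′v) (count-mono f⊆v∪f′)
  where
  f′v : f v ∧ not (v == v) ≡ false
  f′v rewrite ==-refl v = ∧-zeroʳ (f v)
  f⊆v∪f′ : f ⊆ (λ u → (v == u) ∨ (f u ∧ not (v == u)))
  f⊆v∪f′ u fu rewrite fu with v == u
  ... | true  = refl
  ... | false = refl

count-avoid : ∀ {k} (f : Fin k → Bool) (xs : List (Fin k)) →
  length xs < count f → ∃[ u ] (f u ≡ true × All (_≢ u) xs)
count-avoid f []       pos = let u , fu = count-witness f pos in u , fu , []
count-avoid f (x ∷ xs) big with count-avoid (λ u → f u ∧ not (x == u)) xs
                                  (ℕP.≤-pred (ℕP.≤-trans big (count-without x)))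
... | u , f′u , avoids = u , proj₁ (∧-true f′u) , x≢u ∷ avoids
  where
  x≢u : x ≢ u
  x≢u refl = true≢false (trans (sym (==-refl x)) (not-true (proj₂ (∧-true f′u))))

closed : ∀ {n} → Graph n → Fin n → Fin n → Bool
closed G v u = (v == u) ∨ adj G v u

module _ {n} (G : Graph n) where

  closed-refl : ∀ v → closed G v v ≡ true
  closed-refl v rewrite ==-refl v = refl

  closed-adj : ∀ {v u} → adj G v u ≡ true → closed G v u ≡ true
  closed-adj {v} {u} vu rewrite vu with v == u
  ... | true  = refl
  ... | false = refl

  closed-cases : ∀ {v u} → closed G v u ≡ true → v ≡ u ⊎ adj G v u ≡ true
  closed-cases {v} {u} h with ∨-true h
  ... | inj₁ v≡u = inj₁ (==-sound v≡u)
  ... | inj₂ vu  = inj₂ vu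

  closed-sym : ∀ {v u} → closed G v u ≡ true → closed G u v ≡ true
  closed-sym {v} h with closed-cases h
  ... | inj₁ refl = closed-refl v
  ... | inj₂ vu   = closed-adj (trans (adj-sym G _ v) vu)

  closed-adj′ : ∀ {v u} → closed G v u ≡ true → v ≢ u → adj G v u ≡ true
  closed-adj′ h v≢u with closed-cases h
  ... | inj₁ v≡u = ⊥-elim (v≢u v≡u)
  ... | inj₂ vu  = vu

  closed-false : ∀ {v u} → closed G v u ≡ false → v ≢ u × adj G v u ≡ false
  closed-false {v} {u} h = v≢u , ∨-conicalʳ (v == u) (adj G v u) h
    where
    v≢u : v ≢ u
    v≢u refl = true≢false (trans (sym (closed-refl v)) h)

  closed-false-intro : ∀ {v u} → v ≢ u → adj G v u ≡ false → closed G v u ≡ false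
  closed-false-intro v≢u v≁u rewrite ==-false v≢u = v≁u

  separated : ∀ {c u v} → closed G c u ≡ true → closed G c v ≡ false → u ≢ v
  separated cu cv refl = true≢false (trans (sym cu) cv)

  closed-count : ∀ v → count (closed G v) ≡ suc (deg G v)
  closed-count v = count-insert v (irrefl G v)

  deg≤Δ : ∀ v → deg G v ≤ Δ G
  deg≤Δ = maxF-≥ (deg G)
    where
    maxF-≥ : ∀ {k} (f : Fin k → ℕ) a → f a ≤ maxF f
    maxF-≥ f zero    = ℕP.m≤m⊔n _ _
    maxF-≥ f (suc a) = ℕP.≤-trans (maxF-≥ (f ∘ suc) a) (ℕP.m≤n⊔m _ _)

  closed-count≤ : ∀ v → count (closed G v) ≤ suc (Δ G)
  closed-count≤ v = subst (_≤ suc (Δ G)) (sym (closed-count v)) (s≤s (deg≤Δ v))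

Agrees : ∀ {n} → Graph n → Fin n → Fin n → Bool → Set
Agrees G u v true  = adj G u v ≡ true
Agrees G u v false = u ≢ v × adj G u v ≡ false

module _ {n} {G : Graph n} where

  Agrees-sym : ∀ {u v b} → Agrees G u v b → Agrees G v u b
  Agrees-sym {u} {v} {true}  uv             = trans (adj-sym G v u) uv
  Agrees-sym {u} {v} {false} (u≢v , u≁v) = (λ v≡u → u≢v (sym v≡u)) , trans (adj-sym G v u) u≁v

  Agrees-distinct : ∀ {u v b} → Agrees G u v b → u ≢ v
  Agrees-distinct {u} {b = true}  uv refl = true≢false (trans (sym uv) (irrefl G u))
  Agrees-distinct {b = false} (u≢v , _)   = u≢v

  Agrees-adj : ∀ {u v b} → Agrees G u v b → adj G u v ≡ b
  Agrees-adj {b = true}  uv        = uv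
  Agrees-adj {b = false} (_ , u≁v) = u≁v

-- ι realises the pattern P: checked on the pairs a < b only, which suffices for symmetric P.
RealisesAbove : ∀ {n k} → Graph n → (Fin k → Fin n) → (Fin k → Fin k → Bool) → Set
RealisesAbove G ι P = ∀ a b → toℕ a < toℕ b → Agrees G (ι a) (ι b) (P a b)

realises-all : ∀ {n k} {G : Graph n} {ι : Fin k → Fin n} {P : Fin k → Fin k → Bool} →
  (∀ a b → P a b ≡ P b a) → RealisesAbove G ι P → ∀ a b → a ≢ b → Agrees G (ι a) (ι b) (P a b)
realises-all {G = G} {ι} {P} P-sym above a b a≢b with FinP.<-cmp a b
... | tri< a<b _ _ = above a b a<b
... | tri≈ _ a≡b _ = ⊥-elim (a≢b a≡b)
... | tri> _ _ b<a = subst (Agrees G (ι a) (ι b)) (P-sym b a) (Agrees-sym (above b a b<a))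

-- The arithmetic behind f_H: with slack s ≤ Δ − d_G(v), an out-degree o satisfying
-- o + 2 ≤ d_H(v) + s lies strictly below f_H(v) = d_H(v) − 1 + Δ − d_G(v).
below-fH : ∀ o dH s dG D → o + 2 ≤ dH + s → dG + s ≤ D →
  ℤ.+ o ℤ.< ℤ.+ dH ℤ.- ℤ.+ 1 ℤ.+ ℤ.+ D ℤ.- ℤ.+ dG
below-fH o dH s dG D o+2≤dH+s dG+s≤D = subst (ℤ.+ o ℤ.<_) (sym fH≡) (ℤ.+<+ o<)
  where
  key : suc o + suc dG ≤ dH + D
  key = begin
    suc o + suc dG ≡⟨ sym (trans (ℕP.+-assoc o 2 dG) (ℕP.+-suc o (suc dG))) ⟩
    o + 2 + dG     ≤⟨ ℕP.+-monoˡ-≤ dG o+2≤dH+s ⟩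
    dH + s + dG    ≡⟨ trans (ℕP.+-assoc dH s dG) (cong (dH +_) (ℕP.+-comm s dG)) ⟩
    dH + (dG + s)  ≤⟨ ℕP.+-monoʳ-≤ dH dG+s≤D ⟩
    dH + D         ∎
    where open ℕP.≤-Reasoning
  o< : o < (dH + D) ∸ suc dG
  o< = ℕP.m+n≤o⇒m≤o∸n (suc o) key
  dG<dH+D : suc dG ≤ dH + D
  dG<dH+D = ℕP.≤-trans (ℕP.m≤n+m (suc dG) (suc o)) key
  fH≡ : ℤ.+ dH ℤ.- ℤ.+ 1 ℤ.+ ℤ.+ D ℤ.- ℤ.+ dG ≡ ℤ.+ ((dH + D) ∸ suc dG)
  fH≡ = begin
    ℤ.+ dH ℤ.- ℤ.+ 1 ℤ.+ ℤ.+ D ℤ.- ℤ.+ dG    ≡⟨ rearrange (ℤ.+ dH) (ℤ.+ D) (ℤ.+ dG) ⟩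
    (ℤ.+ dH ℤ.+ ℤ.+ D) ℤ.- (ℤ.+ 1 ℤ.+ ℤ.+ dG) ≡⟨ cong₂ ℤ._-_ (sym (ℤP.pos-+ dH D)) (sym (ℤP.pos-+ 1 dG)) ⟩
    ℤ.+ (dH + D) ℤ.- ℤ.+ (suc dG)              ≡⟨ ℤP.m-n≡m⊖n (dH + D) (suc dG) ⟩
    (dH + D) ℤ.⊖ suc dG                        ≡⟨ ℤP.⊖-≥ dG<dH+D ⟩
    ℤ.+ ((dH + D) ∸ suc dG)                    ∎
    where
    open ≡-Reasoning
    open +-*-Solver
    rearrange = solve 3 (λ a b c → ((a :- con (ℤ.+ 1)) :+ b) :- c := (a :+ b) :- (con (ℤ.+ 1) :+ c)) refl

every : ∀ {k} → (Fin k → Bool) → Bool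
every {zero}  f = true
every {suc k} f = f zero ∧ every (f ∘ suc)

every-sound : ∀ {k} (f : Fin k → Bool) → every f ≡ true → ∀ a → f a ≡ true
every-sound {suc k} f h zero    = proj₁ (∧-true h)
every-sound {suc k} f h (suc a) = every-sound (f ∘ suc) (proj₂ (∧-true h)) a

arcTable : ∀ {k} → List (ℕ × ℕ) → Fin k → Fin k → Bool
arcTable arrows a b = any (λ (i , j) → (i ≡ᵇ toℕ a) ∧ (j ≡ᵇ toℕ b)) arrows

-- |EE| and |EO| of a digraph given by its arc table; these are the expressions
-- that EE and EO of Defs compute, as they only depend on the arcs.
arcsOf : ∀ {k} → (Fin k → Fin k → Bool) → List (Fin k × Fin k)
arcsOf {k} O = concatMap (λ u → map (u ,_) (filterᵇ (O u) (allFin k))) (allFin k)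

evenEulerian oddEulerian : ∀ {k} → (Fin k → Fin k → Bool) → ℕ
evenEulerian O = length (filterᵇ (λ S → isEulerian S ∧ isEven (length S)) (sublists (arcsOf O)))
oddEulerian  O = length (filterᵇ (λ S → isEulerian S ∧ not (isEven (length S))) (sublists (arcsOf O)))

-- An AT-certificate on k vertices: an orientation, given by its arcs, of a pattern
-- graph (the underlying graph `edge`), with an assumed degree slack Δ(G) − d_G(v) at
-- each vertex.  Validity of a concrete
-- certificate is a closed Boolean computation, checked by evaluation (refl).
record Certificate (k : ℕ) : Set where
  field
    arrows : List (ℕ × ℕ)
    slack  : Fin k → ℕ

  orient : Fin k → Fin k → Bool
  orient = arcTable arrows

  edge : Fin k → Fin k → Bool
  edge a b = orient a b ∨ orient b a

  antisymmetric outdegrees-small unbalanced valid : Bool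
  antisymmetric    = every (λ a → every (λ b → not (orient a b ∧ orient b a)))
  outdegrees-small = every (λ a → count (orient a) + 2 ≤ᵇ count (edge a) + slack a)
  unbalanced       = not (evenEulerian orient ≡ᵇ oddEulerian orient)
  valid            = antisymmetric ∧ outdegrees-small ∧ unbalanced

-- A valid certificate cannot be realised in a BK-free graph by vertices whose degrees
-- leave the prescribed slack: the realisation would be an f_H-AT induced subgraph.
certificate-excluded : ∀ {n k} (G : Graph n) → BKFree G → (C : Certificate (suc k)) →
  Certificate.valid C ≡ true → (ι : Fin (suc k) → Fin n) → RealisesAbove G ι (Certificate.edge C) →
  (∀ a → deg G (ι a) + Certificate.slack C a ≤ Δ G) → ⊥
certificate-excluded {k = k} G bk C ok ι above slack-ok =
  proj₁ (proj₂ bk (suc k) ι injective (s≤s z≤n)) (D , outdeg-below , EE≢EO)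
  where
  open Certificate C
  antisym-ok : ∀ a b → not (orient a b ∧ orient b a) ≡ true
  antisym-ok a = every-sound (λ b → not (orient a b ∧ orient b a))
    (every-sound (λ a → every (λ b → not (orient a b ∧ orient b a)))
                 (proj₁ (∧-true {antisymmetric} ok)) a)

  outdeg-ok : ∀ a → (count (orient a) + 2 ≤ᵇ count (edge a) + slack a) ≡ true
  outdeg-ok = every-sound (λ a → count (orient a) + 2 ≤ᵇ count (edge a) + slack a)
    (proj₁ (∧-true {outdegrees-small} (proj₂ (∧-true {antisymmetric} ok))))

  unbalanced-ok : not (evenEulerian orient ≡ᵇ oddEulerian orient) ≡ true
  unbalanced-ok = proj₂ (∧-true {outdegrees-small} (proj₂ (∧-true {antisymmetric} ok)))

  orient-antisym : ∀ a b → orient a b ≡ true → orient b a ≡ false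
  orient-antisym a b ab with orient b a in ba
  ... | false = refl
  ... | true  = ⊥-elim (true≢false (trans (sym (cong₂ _∧_ ab ba)) (not-true (antisym-ok a b))))

  agrees : ∀ a b → a ≢ b → Agrees G (ι a) (ι b) (edge a b)
  agrees = realises-all (λ a b → ∨-comm (orient a b) (orient b a)) above

  injective : Injective _≡_ _≡_ ι
  injective {a} {b} ιa≡ιb with a ≟ b
  ... | yes a≡b = a≡b
  ... | no  a≢b = ⊥-elim (Agrees-distinct (agrees a b a≢b) ιa≡ιb)

  adj≡edge : ∀ a b → adj G (ι a) (ι b) ≡ edge a b
  adj≡edge a b with a ≟ b
  ... | no  a≢b  = Agrees-adj (agrees a b a≢b)
  ... | yes refl with orient a a in aa
  ...   | false = irrefl G (ι a)
  ...   | true  = ⊥-elim (true≢false (trans (sym aa) (orient-antisym a a aa)))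

  D : Orientation (induced G ι)
  D = record
    { arc     = orient
    ; arc⇒adj = λ a b ab → trans (adj≡edge a b) (cong (_∨ orient b a) ab)
    ; adj⇒arc = λ a b ab → ∨-true (trans (sym (adj≡edge a b)) ab)
    ; antisym = orient-antisym }

  outdeg-below : ∀ a → ℤ.+ outdeg D a ℤ.< fH G ι a
  outdeg-below a =
    subst (λ d → ℤ.+ count (orient a) ℤ.< ℤ.+ d ℤ.- ℤ.+ 1 ℤ.+ ℤ.+ Δ G ℤ.- ℤ.+ deg G (ι a))
          (sym (count-cong (adj≡edge a)))
          (below-fH (count (orient a)) (count (edge a)) (slack a) (deg G (ι a)) (Δ G)
                    (ℕP.≤ᵇ⇒≤ _ _ (Equivalence.from T-≡ (outdeg-ok a))) (slack-ok a))

  EE≢EO : EE D ≢ EO D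
  EE≢EO EE≡EO = true≢false (trans (sym unbalanced-ok) (cong not (Equivalence.to T-≡ (ℕP.≡⇒≡ᵇ _ _ EE≡EO))))

-- A single vertex, oriented trivially, with slack 2: it has one (even) spanning
-- Eulerian subgraph and out-degree 0 < f(v) as soon as d_G(v) ≤ Δ(G) − 2.
isolated : Certificate 1
isolated = record { arrows = [] ; slack = λ _ → 2 }

closed-large : ∀ {n} (G : Graph n) → BKFree G → ∀ v → Δ G ≤ count (closed G v)
closed-large G bk v with deg G v + 2 ℕP.≤? Δ G
... | yes low = ⊥-elim (certificate-excluded G bk isolated refl (λ _ → v) (λ { 0F 0F () }) (λ { 0F → low }))
... | no ¬low = subst (Δ G ≤_) (sym (closed-count G v))
                      (ℕP.≤-pred (subst (suc (Δ G) ≤_) (ℕP.+-comm (deg G v) 2) (ℕP.≰⇒> ¬low)))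

pair-deficit : ∀ {m} → Fin (2 + m) → ℕ
pair-deficit 0F            = 1
pair-deficit 1F            = 1
pair-deficit (suc (suc _)) = 0

-- K₅ minus an edge on p q x w z (indices 0–4): p, q, x, w form a clique and z is
-- adjacent to p, x, w but not to q.  It is oriented
--   p → q, x, w;   q → x, w;   x → w, z;   w → z;   z → p.
almostK₅ : Certificate 5
almostK₅ = record
  { arrows = (0 , 1) ∷ (0 , 2) ∷ (0 , 3) ∷ (1 , 2) ∷ (1 , 3) ∷ (2 , 3) ∷ (2 , 4) ∷ (3 , 4) ∷ (4 , 0) ∷ []
  ; slack  = pair-deficit }

realises₅ : ∀ {n} {G : Graph n} (P : Fin 5 → Fin 5 → Bool) (ι : Fin 5 → Fin n) →
  Agrees G (ι 0F) (ι 1F) (P 0F 1F) → Agrees G (ι 0F) (ι 2F) (P 0F 2F) →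
  Agrees G (ι 0F) (ι 3F) (P 0F 3F) → Agrees G (ι 0F) (ι 4F) (P 0F 4F) →
  Agrees G (ι 1F) (ι 2F) (P 1F 2F) → Agrees G (ι 1F) (ι 3F) (P 1F 3F) →
  Agrees G (ι 1F) (ι 4F) (P 1F 4F) → Agrees G (ι 2F) (ι 3F) (P 2F 3F) →
  Agrees G (ι 2F) (ι 4F) (P 2F 4F) → Agrees G (ι 3F) (ι 4F) (P 3F 4F) →
  RealisesAbove G ι P
realises₅ P ι h01 h02 h03 h04 h12 h13 h14 h23 h24 h34 = above
  where
  above : RealisesAbove _ ι P
  above 0F 1F _ = h01
  above 0F 2F _ = h02
  above 0F 3F _ = h03
  above 0F 4F _ = h04
  above 1F 2F _ = h12
  above 1F 3F _ = h13
  above 1F 4F _ = h14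
  above 2F 3F _ = h23
  above 2F 4F _ = h24
  above 3F 4F _ = h34
  above 1F 1F (s≤s ())
  above 2F 1F (s≤s ())
  above 2F 2F (s≤s (s≤s ()))
  above (suc (suc (suc _))) 1F (s≤s ())
  above (suc (suc (suc _))) 2F (s≤s (s≤s ()))
  above (suc (suc (suc _))) 3F (s≤s (s≤s (s≤s ())))
  above (suc (suc (suc (suc _)))) 4F (s≤s (s≤s (s≤s (s≤s ()))))

almostK₅-excluded : ∀ {n} (G : Graph n) → BKFree G → ∀ {p q x w z} →
  deg G p + 1 ≤ Δ G → deg G q + 1 ≤ Δ G →
  adj G p q ≡ true → adj G p x ≡ true → adj G p w ≡ true → adj G p z ≡ true →
  adj G q x ≡ true → adj G q w ≡ true → q ≢ z × adj G q z ≡ false →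
  adj G x w ≡ true → adj G x z ≡ true → adj G w z ≡ true → ⊥
almostK₅-excluded G bk {p} {q} {x} {w} {z} p-deficient q-deficient pq px pw pz qx qw q≁z xw xz wz =
  certificate-excluded G bk almostK₅ refl ι
    (realises₅ (Certificate.edge almostK₅) ι pq px pw pz qx qw q≁z xw xz wz) slack-ok
  where
  ι : Fin 5 → Fin _
  ι 0F = p
  ι 1F = q
  ι 2F = x
  ι 3F = w
  ι 4F = z
  slack-ok : ∀ a → deg G (ι a) + pair-deficit a ≤ Δ G
  slack-ok 0F = p-deficient
  slack-ok 1F = q-deficient
  slack-ok (suc (suc a)) = subst (_≤ Δ G) (sym (ℕP.+-identityʳ _)) (deg≤Δ G (ι (suc (suc a))))

clique-insert : ∀ {n} (G : Graph n) {S : Fin n → Bool} (v : Fin n) → IsClique G S →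
  (∀ u → S u ≡ true → v ≢ u → adj G v u ≡ true) → IsClique G (λ u → (v == u) ∨ S u)
clique-insert G {S} v S-clique v~S u w u∈ w∈ u≢w with ∨-true u∈ | ∨-true w∈
... | inj₂ Su | inj₂ Sw = S-clique u w Su Sw u≢w
... | inj₁ v=u | inj₂ Sw with refl ← ==-sound {u = v} v=u = v~S w Sw u≢w
... | inj₂ Su | inj₁ v=w with refl ← ==-sound {u = v} v=w = trans (adj-sym G u v) (v~S u Su (u≢w ∘ sym))
... | inj₁ v=u | inj₁ v=w = ⊥-elim (u≢w (trans (sym (==-sound {u = v} v=u)) (==-sound {u = v} v=w)))

squeeze : ∀ {a b c d} → c ≤ a → d ≤ b → a + b ≤ c + d → a ≡ c × b ≡ d
squeeze {a} {b} {c} {d} c≤a d≤b a+b≤c+d =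
  ℕP.≤-antisym (ℕP.+-cancelʳ-≤ d a c (ℕP.≤-trans (ℕP.+-monoʳ-≤ a d≤b) a+b≤c+d)) c≤a ,
  ℕP.≤-antisym (ℕP.+-cancelˡ-≤ c b d (ℕP.≤-trans (ℕP.+-monoˡ-≤ b c≤a) a+b≤c+d)) d≤b

-- Graphs in which every closed neighbourhood has at least Δ vertices while every
-- clique has fewer (BK-free graphs with ω < Δ, by closed-large).  Closed
-- neighbourhoods then have Δ or Δ + 1 vertices, which leaves little room for one
-- closed neighbourhood to contain others.
module Dense {n} (G : Graph n) (large : ∀ v → Δ G ≤ count (closed G v))
             (ω<Δ : CliqueNumberBelow G (Δ G)) where

  closed-not-clique : ∀ v → ¬ IsClique G (closed G v)
  closed-not-clique v clique = ℕP.<-irrefl refl (ℕP.≤-trans (ω<Δ _ clique) (large v))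

  -- N[x] ⊇ N[w] cannot contain two further vertices: |N[w]| + 2 ≤ |N[x]| ≤ Δ + 1.
  two-extra-excluded : ∀ {w x z z′} → closed G w ⊆ closed G x →
    closed G x z ≡ true → closed G x z′ ≡ true → z ≢ z′ →
    closed G w z ≡ false → closed G w z′ ≡ false → ⊥
  two-extra-excluded {w} {x} {z} {z′} W⊆X Xz Xz′ z≢z′ Wz Wz′ =
    ℕP.<-irrefl refl (begin-strict
      suc (Δ G)                   ≤⟨ s≤s (large w) ⟩
      suc (count (closed G w))    ≤⟨ count-gap z W⊆X∖z′ X∖z′-z Wz ⟩
      count X∖z′                  <⟨ count-gap z′ (λ u h → proj₁ (∧-true h)) Xz′ X∖z′-z′ ⟩
      count (closed G x)          ≤⟨ closed-count≤ G x ⟩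
      suc (Δ G)                   ∎)
    where
    open ℕP.≤-Reasoning
    X∖z′ : Fin n → Bool
    X∖z′ u = closed G x u ∧ not (z′ == u)
    X∖z′-z : X∖z′ z ≡ true
    X∖z′-z = cong₂ _∧_ Xz (cong not (==-false (z≢z′ ∘ sym)))
    X∖z′-z′ : X∖z′ z′ ≡ false
    X∖z′-z′ rewrite ==-refl z′ = ∧-zeroʳ (closed G x z′)
    W⊆X∖z′ : closed G w ⊆ X∖z′
    W⊆X∖z′ u Wu = cong₂ _∧_ (W⊆X u Wu) (cong not (==-false (separated G Wu Wz′ ∘ sym)))

  record Tight (p q x : Fin n) : Set where
    field
      p-deficient : deg G p + 1 ≤ Δ G
      q-deficient : deg G q + 1 ≤ Δ G
      p~q  : adj G p q ≡ true
      p~x  : adj G p x ≡ true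
      q~x  : adj G q x ≡ true
      z    : Fin n
      p~z  : adj G p z ≡ true
      z∉N[q] : closed G q z ≡ false
      x~z  : adj G x z ≡ true
      z′   : Fin n
      q~z′ : adj G q z′ ≡ true
      z′∉N[p] : closed G p z′ ≡ false
      x~z′ : adj G x z′ ≡ true
      w    : Fin n
      p~w  : adj G p w ≡ true
      q~w  : adj G q w ≡ true
      x~w  : adj G x w ≡ true

  module Tightness (Δ≥5 : 5 ≤ Δ G) {p q x : Fin n} (p≢q : p ≢ q)
                   (P⊆X : closed G p ⊆ closed G x) (Q⊆X : closed G q ⊆ closed G x)
                   (I-clique : IsClique G (λ u → closed G p u ∧ closed G q u)) where

    P Q X I U : Fin n → Bool
    P = closed G p
    Q = closed G q
    X = closed G x
    I u = P u ∧ Q u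
    U u = P u ∨ Q u

    U⊆X : U ⊆ X
    U⊆X u Uu with ∨-true Uu
    ... | inj₁ Pu = P⊆X u Pu
    ... | inj₂ Qu = Q⊆X u Qu

    -- Inclusion–exclusion against |U| ≤ |N[x]| ≤ Δ + 1, |I| < Δ ≤ |P|, |Q|
    -- leaves no slack: |P| = |Q| = Δ, |U| = Δ + 1 and |I| = Δ − 1.
    P∪Q : count U + count I ≡ count P + count Q
    P∪Q = count-∪∩ P Q

    U-small : count U ≤ suc (Δ G)
    U-small = ℕP.≤-trans (count-mono U⊆X) (closed-count≤ G x)

    sizes-P-Q : count P ≡ Δ G × count Q ≡ Δ G
    sizes-P-Q = squeeze (large p) (large q) (begin
      count P + count Q     ≡⟨ sym P∪Q ⟩
      count U + count I     ≤⟨ ℕP.+-monoˡ-≤ (count I) U-small ⟩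
      suc (Δ G) + count I   ≡⟨ sym (ℕP.+-suc (Δ G) (count I)) ⟩
      Δ G + suc (count I)   ≤⟨ ℕP.+-monoʳ-≤ (Δ G) (ω<Δ I I-clique) ⟩
      Δ G + Δ G             ∎)
      where open ℕP.≤-Reasoning

    sizes-U-I : suc (Δ G) ≡ count U × Δ G ≡ suc (count I)
    sizes-U-I = squeeze U-small (ω<Δ I I-clique) (ℕP.≤-reflexive (begin
      suc (Δ G) + Δ G         ≡⟨ cong suc (sym (cong₂ _+_ (proj₁ sizes-P-Q) (proj₂ sizes-P-Q))) ⟩
      suc (count P + count Q) ≡⟨ cong suc (sym P∪Q) ⟩
      suc (count U + count I) ≡⟨ sym (ℕP.+-suc (count U) (count I)) ⟩
      count U + suc (count I) ∎))
      where open ≡-Reasoning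

    deficient : ∀ {v} → count (closed G v) ≡ Δ G → deg G v + 1 ≤ Δ G
    deficient {v} size = ℕP.≤-reflexive (trans (ℕP.+-comm (deg G v) 1) (trans (sym (closed-count G v)) size))

    -- neither p nor q is x, since |N[x]| ≥ |U| = Δ + 1
    not-x : ∀ {v} → count (closed G v) ≡ Δ G → v ≢ x
    not-x {v} size refl = ℕP.<-irrefl refl (begin-strict
      count X  ≡⟨ size ⟩
      Δ G      <⟨ ℕP.≤-reflexive (proj₁ sizes-U-I) ⟩
      count U  ≤⟨ count-mono U⊆X ⟩
      count X  ∎)
      where open ℕP.≤-Reasoning

    Px : P x ≡ true
    Px = closed-sym G (P⊆X p (closed-refl G p))

    Qx : Q x ≡ true
    Qx = closed-sym G (Q⊆X q (closed-refl G q))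

    -- p ~ q, for otherwise {p} ∪ I would be a clique with Δ vertices
    p~q : adj G p q ≡ true
    p~q with adj G p q in p≁q
    ... | true  = refl
    ... | false = ⊥-elim (ℕP.<-irrefl refl (begin-strict
      Δ G                                  ≡⟨ proj₂ sizes-U-I ⟩
      suc (count I)                        ≡⟨ sym (count-insert p Ip) ⟩
      count (λ u → (p == u) ∨ I u)        <⟨ ω<Δ _ (clique-insert G p I-clique p~I) ⟩
      Δ G                                  ∎))
      where
      open ℕP.≤-Reasoning
      p~I : ∀ u → I u ≡ true → p ≢ u → adj G p u ≡ true
      p~I u Iu = closed-adj′ G (proj₁ (∧-true Iu))
      Qp : Q p ≡ false
      Qp rewrite ==-false (p≢q ∘ sym) | adj-sym G q p = p≁q
      Ip : I p ≡ false
      Ip rewrite Qp = ∧-zeroʳ (P p)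

    Qp : Q p ≡ true
    Qp = closed-adj G (trans (adj-sym G q p) p~q)

    Pq : P q ≡ true
    Pq = closed-adj G p~q

    -- |I| = Δ − 1 < Δ = |P|, |Q|: p and q have private neighbours
    private-p : ∃[ z ] (P z ∧ not (Q z) ≡ true)
    private-p = count-difference P Q (ℕP.≤-reflexive (trans (sym (proj₂ sizes-U-I)) (sym (proj₁ sizes-P-Q))))

    private-q : ∃[ z ] (Q z ∧ not (P z) ≡ true)
    private-q = count-difference Q P (subst (_< count Q) (count-cong (λ u → ∧-comm (P u) (Q u)))
                  (ℕP.≤-reflexive (trans (sym (proj₂ sizes-U-I)) (sym (proj₂ sizes-P-Q)))))

    -- |I| = Δ − 1 ≥ 4, so I contains a vertex besides p, q and x
    common : ∃[ w ] (I w ≡ true × All (_≢ w) (p ∷ q ∷ x ∷ []))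
    common = count-avoid I (p ∷ q ∷ x ∷ []) (ℕP.≤-pred (subst (5 ≤_) (proj₂ sizes-U-I) Δ≥5))

    -- opaque: clients only use the fields, and unfolding the construction is costly
    opaque
      tight : Tight p q x
      tight with private-p | private-q | common
      ... | z , z∈P∖Q | z′ , z′∈Q∖P | w , Iw , p≢w ∷ q≢w ∷ x≢w ∷ [] = record
        { p-deficient = deficient (proj₁ sizes-P-Q)
        ; q-deficient = deficient (proj₂ sizes-P-Q)
        ; p~q  = p~q
        ; p~x  = closed-adj′ G Px (not-x (proj₁ sizes-P-Q))
        ; q~x  = closed-adj′ G Qx (not-x (proj₂ sizes-P-Q))
        ; z    = z
        ; p~z  = closed-adj′ G Pz (separated G Qp Qz)
        ; z∉N[q] = Qz
        ; x~z  = closed-adj′ G (P⊆X z Pz) (separated G Qx Qz)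
        ; z′   = z′
        ; q~z′ = closed-adj′ G Qz′ (separated G Pq Pz′)
        ; z′∉N[p] = Pz′
        ; x~z′ = closed-adj′ G (Q⊆X z′ Qz′) (separated G Px Pz′)
        ; w    = w
        ; p~w  = closed-adj′ G (proj₁ (∧-true Iw)) p≢w
        ; q~w  = closed-adj′ G (proj₂ (∧-true Iw)) q≢w
        ; x~w  = I-clique x w (cong₂ _∧_ Px Qx) Iw x≢w }
        where
        Pz : P z ≡ true
        Pz = proj₁ (∧-true z∈P∖Q)
        Qz : Q z ≡ false
        Qz = not-true (proj₂ (∧-true z∈P∖Q))
        Qz′ : Q z′ ≡ true
        Qz′ = proj₁ (∧-true z′∈Q∖P)
        Pz′ : P z′ ≡ false
        Pz′ = not-true (proj₂ (∧-true z′∈Q∖P))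

-- In a linear interval graph the closed neighbourhood of the last vertex e of the order
-- is a clique: for members l ≤ m of N[e], the neighbourhood N[l] contains l and e,
-- hence every vertex in between, in particular m.
ClosedNbhd-sym : ∀ {t} (H : Graph t) {a b} → ClosedNbhd H a b → ClosedNbhd H b a
ClosedNbhd-sym H (inj₁ a≡b)        = inj₁ (sym a≡b)
ClosedNbhd-sym H {a} {b} (inj₂ ab) = inj₂ (trans (adj-sym H b a) ab)

last-nbhd-clique : ∀ {t} (H : Graph t) → LinearInterval H → ∀ e → (∀ j → toℕ j ≤ toℕ e) →
  ∀ l m → ClosedNbhd H e l → ClosedNbhd H e m → ClosedNbhd H l m
last-nbhd-clique H linear e ≤e l m el em with ℕP.≤-total (toℕ l) (toℕ m)
... | inj₁ l≤m = linear l l e m l≤m (≤e m) (inj₁ refl) (ClosedNbhd-sym H el)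
... | inj₂ m≤l = ClosedNbhd-sym H (linear m m e l m≤l (≤e l) (inj₁ refl) (ClosedNbhd-sym H em))

module TwoJoin {n} {G : Graph n} (J : Interval2Join G) where
  open Interval2Join J

  H : Graph t
  H = induced G ι

  pred<t : pred t < t
  pred<t with t | nonempty
  ... | suc _ | _ = ℕP.≤-refl

  first last : Fin t
  first = fromℕ< nonempty
  last  = fromℕ< pred<t

  first≤ : ∀ (j : Fin t) → toℕ first ≤ toℕ j
  first≤ j = subst (_≤ toℕ j) (sym (FinP.toℕ-fromℕ< {n = t} nonempty)) z≤n

  ≤last : ∀ (j : Fin t) → toℕ j ≤ toℕ last
  ≤last j = subst (toℕ j ≤_) (sym (FinP.toℕ-fromℕ< pred<t)) (ℕP.<⇒≤pred (FinP.toℕ<n j))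

  -- A₂ is a final segment and A₁ an initial one, so each is everything once it
  -- contains the far end.
  all-A₂ : EndA₂ {t} R first → ∀ l → EndA₂ {t} R l
  all-A₂ first∈A₂ l = ℕP.≤-trans first∈A₂ (first≤ l)

  all-A₁ : EndA₁ {t} L last → ∀ l → EndA₁ {t} L l
  all-A₁ last∈A₁ l = ℕP.≤-<-trans (≤last l) last∈A₁

  ends-trivial : EndA₂ {t} R first → EndA₁ {t} L last → Trivial J
  ends-trivial first∈A₂ last∈A₁ j = all-A₁ last∈A₁ j , all-A₂ first∈A₂ j

  H-adj : ∀ {a b} → ClosedNbhd H a b → a ≢ b → adj G (ι a) (ι b) ≡ true
  H-adj (inj₁ a≡b) a≢b = ⊥-elim (a≢b a≡b)
  H-adj (inj₂ ab)  _   = ab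

  data Place (u : Fin n) : Set where
    inside  : ∀ l → ι l ≡ u → Place u
    outside : (∀ l → ι l ≢ u) → Place u

  place : ∀ u → Place u
  place u with FinP.any? (λ l → ι l ≟ u)
  ... | yes (l , ιl≡u) = inside l ιl≡u
  ... | no  none       = outside (λ l ιl≡u → none (l , ιl≡u))

  inside-nbr : ∀ {j l} → closed G (ι j) (ι l) ≡ true → ClosedNbhd H j l
  inside-nbr jl with closed-cases G jl
  ... | inj₁ ιj≡ιl = inj₁ (ι-inj ιj≡ιl)
  ... | inj₂ ιj~ιl = inj₂ ιj~ιl

  outside-nbr : ∀ {j u} → (∀ l → ι l ≢ u) → closed G (ι j) u ≡ true →
    (EndA₁ {t} L j × B₁ u) ⊎ (EndA₂ {t} R j × B₂ u)
  outside-nbr {j} {u} out ju = no-other j u out (closed-adj′ G ju (out j))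

  side-clique : (A : Fin t → Set) (B : Fin n → Set) →
    (∀ i j → A i → A j → i ≢ j → adj G (ι i) (ι j) ≡ true) → IsCliqueP G B →
    (∀ i u → A i → B u → adj G (ι i) u ≡ true) →
    (S : Fin n → Bool) → (∀ u → S u ≡ true → (∃[ l ] (ι l ≡ u × A l)) ⊎ B u) → IsClique G S
  side-clique A B A-clique B-clique AB S S-side u v Su Sv u≢v with S-side u Su | S-side v Sv
  ... | inj₁ (l , refl , Al) | inj₁ (m , refl , Am) = A-clique l m Al Am (u≢v ∘ cong ι)
  ... | inj₁ (l , refl , Al) | inj₂ Bv               = AB l v Al Bv
  ... | inj₂ Bu               | inj₁ (m , refl , Am) = trans (adj-sym G u (ι m)) (AB m u Am Bu)
  ... | inj₂ Bu               | inj₂ Bv               = B-clique u v Bu Bv u≢v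

  -- If A₂ = V(H) and the last vertex is not in A₁, its closed neighbourhood lies in
  -- A₂ ∪ B₂ and is therefore a clique; symmetrically for the first vertex.
  last-side-clique : EndA₂ {t} R first → ¬ EndA₁ {t} L last → IsClique G (closed G (ι last))
  last-side-clique first∈A₂ last∉A₁ =
    side-clique (EndA₂ R) B₂ A₂clique B₂clique A₂B₂ (closed G (ι last)) side
    where
    side : ∀ u → closed G (ι last) u ≡ true → (∃[ l ] (ι l ≡ u × EndA₂ {t} R l)) ⊎ B₂ u
    side u lu with place u
    ... | inside l ιl≡u = inj₁ (l , ιl≡u , all-A₂ first∈A₂ l)
    ... | outside out with outside-nbr out lu
    ...   | inj₁ (last∈A₁ , _) = ⊥-elim (last∉A₁ last∈A₁)
    ...   | inj₂ (_ , B₂u)     = inj₂ B₂u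

  first-side-clique : EndA₁ {t} L last → ¬ EndA₂ {t} R first → IsClique G (closed G (ι first))
  first-side-clique last∈A₁ first∉A₂ =
    side-clique (EndA₁ L) B₁ A₁clique B₁clique A₁B₁ (closed G (ι first)) side
    where
    side : ∀ u → closed G (ι first) u ≡ true → (∃[ l ] (ι l ≡ u × EndA₁ {t} L l)) ⊎ B₁ u
    side u fu with place u
    ... | inside l ιl≡u = inj₁ (l , ιl≡u , all-A₁ last∈A₁ l)
    ... | outside out with outside-nbr out fu
    ...   | inj₁ (_ , B₁u)      = inj₂ B₁u
    ...   | inj₂ (first∈A₂ , _) = ⊥-elim (first∉A₂ first∈A₂)

-- The central case: a hub x = ι i in A₁ ∩ A₂, the first vertex p not in A₂ and the
-- last vertex q not in A₁.  Then x dominates H, N[p] ∖ H ⊆ B₁, N[q] ∖ H ⊆ B₂ and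
-- N[p] ∩ N[q] is a clique, so p, q, x are Tight.  The common neighbour w sees z or z′
-- (inside H by domination and two-extra-excluded, outside H because it lies in
-- B₁ ∩ B₂), and either way p, q, x, w and z or z′ span an excluded almost-K₅.
module Hub {n} (G : Graph n) (bk : BKFree G) (Δ≥5 : 5 ≤ Δ G) (ω<Δ : CliqueNumberBelow G (Δ G))
           (J : Interval2Join G) where
  open Interval2Join J
  open TwoJoin J
  open Dense G (closed-large G bk) ω<Δ

  module _ (i : Fin t) (i∈A₁ : EndA₁ {t} L i) (i∈A₂ : EndA₂ {t} R i)
           (first∉A₂ : ¬ EndA₂ {t} R first) (last∉A₁ : ¬ EndA₁ {t} L last) where

    x p q : Fin n
    x = ι i
    p = ι first
    q = ι last

    -- since A₁ ∩ A₂ ≠ ∅, every vertex of H lies in A₁ or in A₂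
    covered : ∀ l → EndA₁ {t} L l ⊎ EndA₂ {t} R l
    covered l with toℕ l ℕP.<? L
    ... | yes l∈A₁ = inj₁ l∈A₁
    ... | no  l∉A₁ = inj₂ (ℕP.≤-trans i∈A₂ (ℕP.<⇒≤ (ℕP.<-≤-trans i∈A₁ (ℕP.≮⇒≥ l∉A₁))))

    x-sees-H : ∀ l → closed G x (ι l) ≡ true
    x-sees-H l with i ≟ l
    ... | yes refl = closed-refl G x
    ... | no  i≢l with covered l
    ...   | inj₁ l∈A₁ = closed-adj G (A₁clique i l i∈A₁ l∈A₁ i≢l)
    ...   | inj₂ l∈A₂ = closed-adj G (A₂clique i l i∈A₂ l∈A₂ i≢l)

    dominates : ∀ j → closed G (ι j) ⊆ closed G x
    dominates j u ju with place u
    ... | inside l refl = x-sees-H l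
    ... | outside out with outside-nbr out ju
    ...   | inj₁ (_ , B₁u) = closed-adj G (A₁B₁ i u i∈A₁ B₁u)
    ...   | inj₂ (_ , B₂u) = closed-adj G (A₂B₂ i u i∈A₂ B₂u)

    B₁∩B₂-sees-H : ∀ {u} → B₁ u → B₂ u → ∀ l → adj G (ι l) u ≡ true
    B₁∩B₂-sees-H B₁u B₂u l with covered l
    ... | inj₁ l∈A₁ = A₁B₁ l _ l∈A₁ B₁u
    ... | inj₂ l∈A₂ = A₂B₂ l _ l∈A₂ B₂u

    p-outside : ∀ {u} → (∀ l → ι l ≢ u) → closed G p u ≡ true → B₁ u
    p-outside out pu with outside-nbr out pu
    ... | inj₁ (_ , B₁u)      = B₁u
    ... | inj₂ (first∈A₂ , _) = ⊥-elim (first∉A₂ first∈A₂)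

    q-outside : ∀ {u} → (∀ l → ι l ≢ u) → closed G q u ≡ true → B₂ u
    q-outside out qu with outside-nbr out qu
    ... | inj₁ (last∈A₁ , _) = ⊥-elim (last∉A₁ last∈A₁)
    ... | inj₂ (_ , B₂u)     = B₂u

    -- first ≤ i < L ≤ last
    p≢q : p ≢ q
    p≢q ιfirst≡ιlast = ℕP.<-irrefl (cong toℕ (ι-inj ιfirst≡ιlast))
      (ℕP.≤-<-trans (first≤ i) (ℕP.<-≤-trans i∈A₁ (ℕP.≮⇒≥ last∉A₁)))

    -- inside H, N[p] ∩ N[q] ⊆ N_H[last], a clique; outside H it lies in B₁ ∩ B₂
    common-clique : IsClique G (λ u → closed G p u ∧ closed G q u)
    common-clique u v Iu Iv u≢v with ∧-true Iu | ∧-true Iv | place u | place v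
    ... | _ , qu | _ , qv | inside l refl | inside m refl =
      H-adj (last-nbhd-clique H linear last ≤last l m (inside-nbr qu) (inside-nbr qv)) (u≢v ∘ cong ι)
    ... | _ | pv , qv | inside l refl | outside out =
      B₁∩B₂-sees-H (p-outside out pv) (q-outside out qv) l
    ... | pu , qu | _ | outside out | inside m refl =
      trans (adj-sym G u (ι m)) (B₁∩B₂-sees-H (p-outside out pu) (q-outside out qu) m)
    ... | _ , qu | _ , qv | outside outu | outside outv =
      B₂clique u v (q-outside outu qu) (q-outside outv qv) u≢v

    open Tight (Tightness.tight Δ≥5 p≢q (dominates first) (dominates last) common-clique)

    w≢z : w ≢ z
    w≢z = separated G (closed-adj G q~w) z∉N[q]

    w≢z′ : w ≢ z′
    w≢z′ = separated G (closed-adj G p~w) z′∉N[p]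

    w-sees : adj G w z ≡ true ⊎ adj G w z′ ≡ true
    w-sees with place w
    ... | inside l ιl≡w with adj G w z in w≁z | adj G w z′ in w≁z′
    ...   | true  | _     = inj₁ refl
    ...   | false | true  = inj₂ refl
    ...   | false | false = ⊥-elim (two-extra-excluded
              (subst (λ y → closed G y ⊆ closed G x) ιl≡w (dominates l))
              (closed-adj G x~z) (closed-adj G x~z′) (separated G (closed-adj G q~z′) z∉N[q] ∘ sym)
              (closed-false-intro G w≢z w≁z) (closed-false-intro G w≢z′ w≁z′))
    w-sees | outside out with place z
    ... | inside l ιl≡z = inj₁ (subst (λ y → adj G w y ≡ true) ιl≡z
            (trans (adj-sym G w (ι l)) (B₁∩B₂-sees-H B₁w (q-outside out (closed-adj G q~w)) l)))
      where
      B₁w : B₁ w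
      B₁w = p-outside out (closed-adj G p~w)
    ... | outside outz =
      inj₁ (B₁clique w z (p-outside out (closed-adj G p~w)) (p-outside outz (closed-adj G p~z)) w≢z)

    excluded : ⊥
    excluded with w-sees
    ... | inj₁ w~z  = almostK₅-excluded G bk p-deficient q-deficient
                        p~q p~x p~w p~z q~x q~w (closed-false G z∉N[q]) x~w x~z w~z
    ... | inj₂ w~z′ = almostK₅-excluded G bk q-deficient p-deficient
                        (trans (adj-sym G q p) p~q) q~x q~w q~z′ p~x p~w (closed-false G z′∉N[p]) x~w x~z′ w~z′

lemma2p4 : ∀ {n} (G : Graph n) → BKFree G → 9 ≤ Δ G → CliqueNumberBelow G (Δ G) →
    (J : Interval2Join G) → Trivial J ⊎ Canonical J
lemma2p4 G bk Δ≥9 ω<Δ J = dichotomy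
  where
  open Interval2Join J
  open TwoJoin J
  open Dense G (closed-large G bk) ω<Δ

  Δ≥5 : 5 ≤ Δ G
  Δ≥5 = ℕP.≤-trans (ℕP.m≤m+n 5 4) Δ≥9

  dichotomy : Trivial J ⊎ Canonical J
  dichotomy with FinP.any? (λ i → (toℕ i ℕP.<? L) ×-dec (R ℕP.≤? toℕ i))
  ... | no  A₁∩A₂=∅          = inj₂ (λ i i∈A₁∩A₂ → A₁∩A₂=∅ (i , i∈A₁∩A₂))
  ... | yes (i , i∈A₁ , i∈A₂) with R ℕP.≤? toℕ first | toℕ last ℕP.<? L
  ...   | yes first∈A₂ | yes last∈A₁ = inj₁ (ends-trivial first∈A₂ last∈A₁)
  ...   | yes first∈A₂ | no  last∉A₁ =
    ⊥-elim (closed-not-clique (ι last) (last-side-clique first∈A₂ last∉A₁))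
  ...   | no  first∉A₂ | yes last∈A₁ =
    ⊥-elim (closed-not-clique (ι first) (first-side-clique last∈A₁ first∉A₂))
  ...   | no  first∉A₂ | no  last∉A₁ =
    ⊥-elim (Hub.excluded G bk Δ≥5 ω<Δ J i i∈A₁ i∈A₂ first∉A₂ last∉A₁)
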